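{- In $\mathrm{LIC}$ there exist a $(T,T')$-path $P$, an $(s_1,s'_1)$-path $P_1$ and an $(s_2,s'_2)$-path $P_2$, pairwise edge-disjoint and such that no two of them cross at a vertex other than $a,b,c,d,u_5,u_6$. Likewise, there exist a $(T,T')$-path $P$, an $(s_3,s'_3)$-path $P_1$ and an $(s_4,s'_4)$-path $P_2$ in $\mathrm{LIC}$, pairwise edge-disjoint and such that no two of them cross at a vertex other than $a,b,c,d,u_5,u_6$.
   Context: $\mathrm{LIC}$ is the plane graph drawn with straight edges on the vertices (with coordinates) $t_1(4,22)$, $t_2(4,10)$, $t'_1(24,22)$, $t'_2(24,10)$, $s_1(6,24)$, $s_2(10,24)$, $s_3(18,24)$, $s_4(22,24)$, $s'_1(6,8)$, $s'_2(10,8)$, $s'_3(18,8)$, $s'_4(22,8)$, $u_1(6,22)$, $u_2(10,22)$, $u_3(18,22)$, $u_4(22,22)$, $u_5(10,18)$, $u_6(18,18)$, $u_7(10,14)$, $u_8(18,14)$, $u_9(6,10)$, $u_{10}(10,10)$, $u_{11}(18,10)$, $u_{12}(22,10)$, $a(14,18)$, $b(12,16)$, $c(16,16)$, $d(14,14)$, with edges $s_1u_1, t_1u_1, u_1u_2, u_1u_5, s_2u_2, u_2u_5, u_2a, s_3u_3, u_3u_4, u_3u_6, u_3a, s_4u_4, t'_1u_4, u_4u_6, u_5u_7, u_5b, u_6u_8, u_6c, u_7u_9, u_7u_{10}, u_7b, u_8u_{11}, u_8u_{12}, u_8c, t_2u_9, s'_1u_9, u_9u_{10}, s'_2u_{10},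 u_{10}d, s'_3u_{11}, u_{11}u_{12}, u_{11}d, t'_2u_{12}, s'_4u_{12}, ab, ac, bd, cd$. Let $T=\{t_1,t_2\}$, $T'=\{t'_1,t'_2\}$; a $(T,T')$-path is a path with one extremity in $T$ and the other in $T'$. A path is a sequence of distinct consecutive edges. Two edge-disjoint paths $P_1,P_2$ cross at a vertex $v$ if there are four edges $e_1,\dots,e_4$ incident to $v$, in this cyclic order around $v$ in the drawing, with $e_1,e_3$ consecutive in $P_1$ and $e_2,e_4$ consecutive in $P_2$. In $\mathrm{LIC}$ the crossing vertices are exactly $a,b,c,d,u_5,u_6$: paths are not allowed to cross at any other vertex. -}

module Defs where

open import Data.Nat using (ℕ)
import Data.Nat as N
open import Data.Integer using (ℤ; +_; _-_; _*_; _<_; _≟_; _<?_)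
open import Data.Bool using (Bool; true; false; if_then_else_; _∨_; _∧_)
open import Data.Product using (_×_; _,_; Σ-syntax; ∃-syntax)
open import Data.Sum using (_⊎_)
open import Data.List using (List; []; _∷_; head; last)
open import Data.Maybe using (Maybe; just)
open import Data.List.Membership.Propositional using (_∈_)
open import Data.List.Relation.Unary.All using (All)
open import Data.List.Relation.Unary.AllPairs using (AllPairs)
open import Relation.Binary.PropositionalEquality using (_≡_)
open import Relation.Nullary using (¬_; does)

data V : Set where
  t1 t2 t1' t2' : V
  s1 s2 s3 s4 s1' s2' s3' s4' : V
  u1 u2 u3 u4 u5 u6 u7 u8 u9 u10 u11 u12 : V
  a b c d : V

coord : V → ℤ × ℤ
coord t1  = + 4  , + 22
coord t2  = + 4  , + 10
coord t1' = + 24 , + 22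
coord t2' = + 24 , + 10
coord s1  = + 6  , + 24
coord s2  = + 10 , + 24
coord s3  = + 18 , + 24
coord s4  = + 22 , + 24
coord s1' = + 6  , + 8
coord s2' = + 10 , + 8
coord s3' = + 18 , + 8
coord s4' = + 22 , + 8
coord u1  = + 6  , + 22
coord u2  = + 10 , + 22
coord u3  = + 18 , + 22
coord u4  = + 22 , + 22
coord u5  = + 10 , + 18
coord u6  = + 18 , + 18
coord u7  = + 10 , + 14
coord u8  = + 18 , + 14
coord u9  = + 6  , + 10
coord u10 = + 10 , + 10
coord u11 = + 18 , + 10
coord u12 = + 22 , + 10
coord a   = + 14 , + 18
coord b   = + 12 , + 16
coord c   = + 16 , + 16
coord d   = + 14 , + 14

-- edge list of LIC (each undirected edge listed once)
edges : List (V × V)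
edges =
  (s1 , u1) ∷ (t1 , u1) ∷ (u1 , u2) ∷ (u1 , u5) ∷ (s2 , u2) ∷ (u2 , u5) ∷
  (u2 , a) ∷ (s3 , u3) ∷ (u3 , u4) ∷ (u3 , u6) ∷ (u3 , a) ∷ (s4 , u4) ∷
  (t1' , u4) ∷ (u4 , u6) ∷ (u5 , u7) ∷ (u5 , b) ∷ (u6 , u8) ∷ (u6 , c) ∷
  (u7 , u9) ∷ (u7 , u10) ∷ (u7 , b) ∷ (u8 , u11) ∷ (u8 , u12) ∷ (u8 , c) ∷
  (t2 , u9) ∷ (s1' , u9) ∷ (u9 , u10) ∷ (s2' , u10) ∷ (u10 , d) ∷
  (s3' , u11) ∷ (u11 , u12) ∷ (u11 , d) ∷ (t2' , u12) ∷ (s4' , u12) ∷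
  (a , b) ∷ (a , c) ∷ (b , d) ∷ (c , d) ∷ []

Adj : V → V → Set
Adj x y = ((x , y) ∈ edges) ⊎ ((y , x) ∈ edges)

SameEdge : V × V → V × V → Set
SameEdge (x , y) (x' , y') = (x ≡ x' × y ≡ y') ⊎ (x ≡ y' × y ≡ x')

steps : List V → List (V × V)
steps (x ∷ y ∷ rest) = (x , y) ∷ steps (y ∷ rest)
steps _ = []

-- the pairs of consecutive edges: (v_{i-1} , v_i , v_{i+1}) means the
-- edges v_{i-1}v_i and v_i v_{i+1} are consecutive in the walk
turns : List V → List (V × V × V)
turns (x ∷ y ∷ z ∷ rest) = (x , y , z) ∷ turns (y ∷ z ∷ rest)
turns _ = []

-- a path in LIC (paper's sense): a sequence of distinct consecutive edges
record IsPath (p : List V) : Set where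
  field
    consecutive : All (λ e → Adj (Data.Product.proj₁ e) (Data.Product.proj₂ e)) (steps p)
    distinct    : AllPairs (λ e f → ¬ SameEdge e f) (steps p)

Ends : List V → V → V → Set
Ends p x y = (head p ≡ just x × last p ≡ just y) ⊎ (head p ≡ just y × last p ≡ just x)

EdgeDisjoint : List V → List V → Set
EdgeDisjoint p q = All (λ e → All (λ f → ¬ SameEdge e f) (steps q)) (steps p)

vec : V → V → ℤ × ℤ
vec v x = (Data.Product.proj₁ (coord x) - Data.Product.proj₁ (coord v)) ,
          (Data.Product.proj₂ (coord x) - Data.Product.proj₂ (coord v))

cross : ℤ × ℤ → ℤ × ℤ → ℤ
cross (x1 , y1) (x2 , y2) = x1 * y2 - y1 * x2

-- upper half (angle in [0,π)) gets 0, lower half (angle in [π,2π)) gets 1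
half : ℤ × ℤ → ℕ
half (x , y) = if does (+ 0 <? y) ∨ (does (y ≟ + 0) ∧ does (+ 0 <? x)) then 0 else 1

-- strictly smaller polar angle in [0,2π)
AngleLt : ℤ × ℤ → ℤ × ℤ → Set
AngleLt p q = (half p N.< half q) ⊎ (half p ≡ half q × + 0 < cross p q)

-- directions p, q, r occur in this counterclockwise cyclic order
Cyc3 : ℤ × ℤ → ℤ × ℤ → ℤ × ℤ → Set
Cyc3 p q r = (AngleLt p q × AngleLt q r) ⊎ (AngleLt q r × AngleLt r p)
           ⊎ (AngleLt r p × AngleLt p q)

CyclicOrder : V → V → V → V → V → Set
CyclicOrder v x1 x2 x3 x4 =
  (Cyc3 (vec v x1) (vec v x2) (vec v x3) × Cyc3 (vec v x1) (vec v x3) (vec v x4))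
  ⊎ (Cyc3 (vec v x4) (vec v x3) (vec v x2) × Cyc3 (vec v x4) (vec v x2) (vec v x1))

ConsecAt : List V → V → V → V → Set
ConsecAt p v x y = ((x , v , y) ∈ turns p) ⊎ ((y , v , x) ∈ turns p)

Cross : List V → List V → V → Set
Cross p q v = ∃[ x1 ] ∃[ x2 ] ∃[ x3 ] ∃[ x4 ]
  (CyclicOrder v x1 x2 x3 x4 × ConsecAt p v x1 x3 × ConsecAt q v x2 x4)

Allowed : V → Set
Allowed v = (v ≡ a) ⊎ (v ≡ b) ⊎ (v ≡ c) ⊎ (v ≡ d) ⊎ (v ≡ u5) ⊎ (v ≡ u6)

NoBadCross : List V → List V → Set
NoBadCross p q = (v : V) → Cross p q v → Allowed v

InT : V → Set
InT v = (v ≡ t1) ⊎ (v ≡ t2)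

InT' : V → Set
InT' v = (v ≡ t1') ⊎ (v ≡ t2')

GoodTriple : V → V → V → V → Set
GoodTriple x1 y1 x2 y2 =
  Σ[ P ∈ List V ] Σ[ P1 ∈ List V ] Σ[ P2 ∈ List V ]
    ( IsPath P × (∃[ t ] ∃[ t' ] (InT t × InT' t' × Ends P t t'))
    × IsPath P1 × Ends P1 x1 y1
    × IsPath P2 × Ends P2 x2 y2
    × EdgeDisjoint P P1 × EdgeDisjoint P P2 × EdgeDisjoint P1 P2
    × NoBadCross P P1 × NoBadCross P P2 × NoBadCross P1 P2 )

-- Each half is witnessed by three explicit paths, and every required property is a
-- decidable condition on finite data, so it is verified by evaluation.  The one piece
-- of reasoning is that two walks can only cross at v through a turn of each at v, so
-- non-crossing reduces to inspecting the finitely many pairs of turns.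
module Submission where

open import Defs
open import Data.Fin using (Fin; #_)
import Data.Fin.Properties as Fin
open import Data.Integer using (+_; _<?_)
open import Data.List using (List; []; _∷_; length; lookup)
open import Data.List.Membership.Propositional using (_∈_)
open import Data.List.Relation.Unary.All as All using (All; all?)
open import Data.List.Relation.Unary.AllPairs using (allPairs?)
import Data.Nat as ℕ
import Data.Nat.Properties as ℕ
open import Data.Product using (_×_; _,_; ∃-syntax)
open import Data.Product.Properties using (≡-dec)
open import Data.Sum using (_⊎_; inj₁; inj₂)
open import Function.Bundles using (mk↣)
open import Relation.Binary.Definitions using (DecidableEquality)
open import Relation.Binary.PropositionalEquality using (_≡_; refl; cong; sym; trans)
open import Relation.Nullary using (Dec; ¬?)
open import Relation.Nullary.Decidable
  using (True; toWitness; map′; via-injection; _×-dec_; _⊎-dec_; _→-dec_)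

vertices : List V
vertices = t1 ∷ t2 ∷ t1' ∷ t2' ∷ s1 ∷ s2 ∷ s3 ∷ s4 ∷ s1' ∷ s2' ∷ s3' ∷ s4' ∷ u1 ∷ u2 ∷ u3 ∷ u4 ∷ u5 ∷ u6 ∷ u7 ∷ u8 ∷ u9 ∷ u10 ∷ u11 ∷ u12 ∷ a ∷ b ∷ c ∷ d ∷ []

index : V → Fin (length vertices)
index t1  = # 0
index t2  = # 1
index t1' = # 2
index t2' = # 3
index s1  = # 4
index s2  = # 5
index s3  = # 6
index s4  = # 7
index s1' = # 8
index s2' = # 9
index s3' = # 10
index s4' = # 11
index u1  = # 12
index u2  = # 13
index u3  = # 14
index u4  = # 15
index u5  = # 16
index u6  = # 17
index u7  = # 18
index u8  = # 19
index u9  = # 20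
index u10 = # 21
index u11 = # 22
index u12 = # 23
index a   = # 24
index b   = # 25
index c   = # 26
index d   = # 27

lookup-index : ∀ v → lookup vertices (index v) ≡ v
lookup-index t1  = refl
lookup-index t2  = refl
lookup-index t1' = refl
lookup-index t2' = refl
lookup-index s1  = refl
lookup-index s2  = refl
lookup-index s3  = refl
lookup-index s4  = refl
lookup-index s1' = refl
lookup-index s2' = refl
lookup-index s3' = refl
lookup-index s4' = refl
lookup-index u1  = refl
lookup-index u2  = refl
lookup-index u3  = refl
lookup-index u4  = refl
lookup-index u5  = refl
lookup-index u6  = refl
lookup-index u7  = refl
lookup-index u8  = refl
lookup-index u9  = refl
lookup-index u10 = refl
lookup-index u11 = refl
lookup-index u12 = refl
lookup-index a   = refl
lookup-index b   = refl
lookup-index c   = refl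
lookup-index d   = refl

index-injective : ∀ {v w} → index v ≡ index w → v ≡ w
index-injective {v} {w} eq =
  trans (sym (lookup-index v)) (trans (cong (lookup vertices) eq) (lookup-index w))

_≟_ : DecidableEquality V
_≟_ = via-injection (mk↣ index-injective) Fin._≟_

open import Data.List.Membership.DecPropositional (≡-dec _≟_ _≟_) using (_∈?_)

adj? : ∀ x y → Dec (Adj x y)
adj? x y = ((x , y) ∈? edges) ⊎-dec ((y , x) ∈? edges)

sameEdge? : ∀ e f → Dec (SameEdge e f)
sameEdge? (x , y) (x' , y') = ((x ≟ x') ×-dec (y ≟ y')) ⊎-dec ((x ≟ y') ×-dec (y ≟ x'))

isPath? : ∀ p → Dec (IsPath p)
isPath? p = map′ (λ (cs , ds) → record { consecutive = cs ; distinct = ds })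
                 (λ π → IsPath.consecutive π , IsPath.distinct π)
                 (all? (λ (x , y) → adj? x y) (steps p)
                   ×-dec allPairs? (λ e f → ¬? (sameEdge? e f)) (steps p))

edgeDisjoint? : ∀ p q → Dec (EdgeDisjoint p q)
edgeDisjoint? p q = all? (λ e → all? (λ f → ¬? (sameEdge? e f)) (steps q)) (steps p)

angleLt? : ∀ p q → Dec (AngleLt p q)
angleLt? p q = (half p ℕ.<? half q) ⊎-dec ((half p ℕ.≟ half q) ×-dec (+ 0 <? cross p q))

cyc3? : ∀ p q r → Dec (Cyc3 p q r)
cyc3? p q r = (angleLt? p q ×-dec angleLt? q r) ⊎-dec (angleLt? q r ×-dec angleLt? r p)
              ⊎-dec (angleLt? r p ×-dec angleLt? p q)

cyclicOrder? : ∀ v x₁ x₂ x₃ x₄ → Dec (CyclicOrder v x₁ x₂ x₃ x₄)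
cyclicOrder? v x₁ x₂ x₃ x₄ =
  (cyc3? (vec v x₁) (vec v x₂) (vec v x₃) ×-dec cyc3? (vec v x₁) (vec v x₃) (vec v x₄))
  ⊎-dec (cyc3? (vec v x₄) (vec v x₃) (vec v x₂) ×-dec cyc3? (vec v x₄) (vec v x₂) (vec v x₁))

allowed? : ∀ v → Dec (Allowed v)
allowed? v = (v ≟ a) ⊎-dec (v ≟ b) ⊎-dec (v ≟ c) ⊎-dec (v ≟ d) ⊎-dec (v ≟ u5) ⊎-dec (v ≟ u6)

Turn : Set
Turn = V × V × V

-- The four disjuncts are the four ways of orienting the two turns.
TurnsCross : Turn → Turn → Set
TurnsCross (x , v , y) (x' , v' , y') = v ≡ v' ×
  (CyclicOrder v x x' y y' ⊎ CyclicOrder v x y' y x' ⊎ CyclicOrder v y x' x y' ⊎ CyclicOrder v y y' x x')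

turnsCross? : ∀ t t' → Dec (TurnsCross t t')
turnsCross? (x , v , y) (x' , v' , y') = (v ≟ v') ×-dec
  (cyclicOrder? v x x' y y' ⊎-dec cyclicOrder? v x y' y x'
   ⊎-dec cyclicOrder? v y x' x y' ⊎-dec cyclicOrder? v y y' x x')

NoBadTurnCross : List V → List V → Set
NoBadTurnCross p q =
  All (λ t@(_ , v , _) → All (λ t' → TurnsCross t t' → Allowed v) (turns q)) (turns p)

noBadTurnCross? : ∀ p q → Dec (NoBadTurnCross p q)
noBadTurnCross? p q =
  all? (λ t@(_ , v , _) → all? (λ t' → turnsCross? t t' →-dec allowed? v) (turns q)) (turns p)

noBadTurnCross⇒noBadCross : ∀ p q → NoBadTurnCross p q → NoBadCross p q
noBadTurnCross⇒noBadCross p q ok v (_ , _ , _ , _ , o , inj₁ i , inj₁ j) =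
  All.lookup (All.lookup ok i) j (refl , inj₁ o)
noBadTurnCross⇒noBadCross p q ok v (_ , _ , _ , _ , o , inj₁ i , inj₂ j) =
  All.lookup (All.lookup ok i) j (refl , inj₂ (inj₁ o))
noBadTurnCross⇒noBadCross p q ok v (_ , _ , _ , _ , o , inj₂ i , inj₁ j) =
  All.lookup (All.lookup ok i) j (refl , inj₂ (inj₂ (inj₁ o)))
noBadTurnCross⇒noBadCross p q ok v (_ , _ , _ , _ , o , inj₂ i , inj₂ j) =
  All.lookup (All.lookup ok i) j (refl , inj₂ (inj₂ (inj₂ o)))

goodTriple : ∀ {x₁ y₁ x₂ y₂} P P₁ P₂ →
  ∃[ t ] ∃[ t' ] (InT t × InT' t' × Ends P t t') → Ends P₁ x₁ y₁ → Ends P₂ x₂ y₂ →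
  {_ : True (isPath? P)} {_ : True (isPath? P₁)} {_ : True (isPath? P₂)} →
  {_ : True (edgeDisjoint? P P₁)} {_ : True (edgeDisjoint? P P₂)} {_ : True (edgeDisjoint? P₁ P₂)} →
  {_ : True (noBadTurnCross? P P₁)} {_ : True (noBadTurnCross? P P₂)} {_ : True (noBadTurnCross? P₁ P₂)} →
  GoodTriple x₁ y₁ x₂ y₂
goodTriple P P₁ P₂ ends ends₁ ends₂ {π} {π₁} {π₂} {δ₁} {δ₂} {δ₁₂} {κ₁} {κ₂} {κ₁₂} =
  P , P₁ , P₂ ,
  toWitness π , ends , toWitness π₁ , ends₁ , toWitness π₂ , ends₂ ,
  toWitness δ₁ , toWitness δ₂ , toWitness δ₁₂ ,
  noBadTurnCross⇒noBadCross P P₁ (toWitness κ₁) ,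
  noBadTurnCross⇒noBadCross P P₂ (toWitness κ₂) ,
  noBadTurnCross⇒noBadCross P₁ P₂ (toWitness κ₁₂)

lemma7 : GoodTriple s1 s1' s2 s2' × GoodTriple s3 s3' s4 s4'
lemma7 =
  goodTriple (t1 ∷ u1 ∷ u5 ∷ b ∷ d ∷ u11 ∷ u12 ∷ t2' ∷ [])
             (s1 ∷ u1 ∷ u2 ∷ u5 ∷ u7 ∷ u9 ∷ s1' ∷ [])
             (s2 ∷ u2 ∷ a ∷ b ∷ u7 ∷ u10 ∷ s2' ∷ [])
             (t1 , t2' , inj₁ refl , inj₂ refl , inj₁ (refl , refl))
             (inj₁ (refl , refl)) (inj₁ (refl , refl))
  ,
  goodTriple (t1 ∷ u1 ∷ u2 ∷ a ∷ c ∷ u6 ∷ u4 ∷ t1' ∷ [])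
             (s3 ∷ u3 ∷ a ∷ b ∷ d ∷ u11 ∷ s3' ∷ [])
             (s4 ∷ u4 ∷ u3 ∷ u6 ∷ u8 ∷ u12 ∷ s4' ∷ [])
             (t1 , t1' , inj₁ refl , inj₁ refl , inj₁ (refl , refl))
             (inj₁ (refl , refl)) (inj₁ (refl , refl))
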